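{- Let $G$ be a graph with a fixed total order on its edges, $d,\ell$ integers, and $(A,B)$ an independent pair such that every vertex of $G$ lies on some path $P_{ab}$ with $a\in A$, $b\in B$. Then for every $b\in B$, the escape graph of $b$ has no directed cycle.
   Context: $d(x,y)$ is shortest-path distance in $G$, $B(x,k)=\{y:d(x,y)\le k\}$. Extend the edge order to paths by comparing from the end: a path with no edge is smallest; if two paths have the same last edge compare them with that edge removed; otherwise compare their last edges. $P_{ab}$ is the path from $a$ to $b$ of minimum length that is smallest in this order among minimum-length paths. A pair $(A,B)$ of disjoint vertex sets is $d$-localized if the vertices of $A\cup B$ are pairwise at distance at least $\ell+1$ and $d(a,b)\le 2\ell-2^{d+2}-3$ for $a\in A,b\in B$. For $a\in A,b\in B$, $c_{ab}$ (resp. $c_{ba}$) is the vertex of $P_{ab}$ at distance $\ell-3$ from $a$ (resp. $b$). A $d$-localized pair is independent if for all $a\in A,b\in B$, $B(c_{ab},\ell)\cap(A\cup B)=\{a,b\}$ and $B(c_{ba},\ell)\cap(A\cup B)=\{a,b\}$. The root section $RS(a)$ of $a\in A$ is the set of vertices of the subpaths of $P_{ab}$ from $a$ to $c_{ab}$, over all $b\in B$. An escape from $a\in A$ is an edge $uv$ with $u\in RS(a)$, $v\notin RS(a)$, which is not an edge of any $P_{ab'}$, $b'\in B$. It is an escape from $a$ to $a'$ for $b$ if $a'\in A\setminus\{a\}$, $b\in B$, $u$ lies on $P_{ab}$ and $v$ lies on $P_{a'b}$. The escape graph of $b\in B$ is the directed graph with vertex set $A$ having an arc $aa'$ whenever there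 is an escape from $a$ to $a'$ for $b$. -}

module Defs where

open import Data.Nat using (ℕ; zero; suc; _≤_; _<_; _∸_; _*_; _^_)
open import Data.Integer as ℤ using (ℤ; +_; -[1+_]; _-_)
open import Data.Fin using (Fin)
open import Data.List using (List; []; _∷_; _++_; [_]; reverse; take)
open import Data.List.Membership.Propositional using (_∈_)
open import Data.List.Relation.Unary.Unique.Propositional using (Unique)
open import Data.List.Relation.Unary.Linked using (Linked)
open import Data.Maybe using (Maybe; just; nothing)
open import Data.Product using (Σ; ∃; ∃-syntax; _×_; _,_)
open import Data.Sum using (_⊎_)
open import Relation.Nullary using (¬_)
open import Data.Empty using (⊥)
open import Relation.Binary.PropositionalEquality using (_≡_; _≢_)

-- The total order on the (finitely many) edges is
-- given by an injective ranking: rank u v (= rank v u) is the position of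
-- the edge uv; distinct edges have distinct ranks.

record Graph : Set₁ where
  field
    n        : ℕ
    Adj      : Fin n → Fin n → Set
    Adj-sym  : ∀ {u v} → Adj u v → Adj v u
    Adj-irr  : ∀ {u} → ¬ Adj u u
    rank     : Fin n → Fin n → ℕ
    rank-sym : ∀ u v → rank u v ≡ rank v u
    rank-inj : ∀ {u v x y} → Adj u v → Adj x y → rank u v ≡ rank x y →
               (u ≡ x × v ≡ y) ⊎ (u ≡ y × v ≡ x)

-- ⌈ 2 ^ k ⌉ for an integer k (equals 2^k when k ≥ 0, and 1 when k < 0).
pow2ceil : ℤ → ℕ
pow2ceil (+ k)    = 2 ^ k
pow2ceil -[1+ _ ] = 1

nth : ∀ {A : Set} → List A → ℕ → Maybe A
nth []       _       = nothing
nth (x ∷ xs) zero    = just x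
nth (x ∷ xs) (suc i) = nth xs i

data LexLe : List ℕ → List ℕ → Set where
  nil≤ : ∀ {ys} → LexLe [] ys
  lt   : ∀ {x y xs ys} → x < y → LexLe (x ∷ xs) (y ∷ ys)
  eq   : ∀ {x xs ys} → LexLe xs ys → LexLe (x ∷ xs) (x ∷ ys)

module _ (G : Graph) where
  open Graph G

  V : Set
  V = Fin n

  data Walk : V → V → Set where
    stop   : ∀ x → Walk x x
    _∷⟨_⟩_ : ∀ x {y z} → Adj x y → Walk y z → Walk x z

  len : ∀ {x y} → Walk x y → ℕ
  len (stop _)          = 0
  len (_ ∷⟨ _ ⟩ w)   = suc (len w)

  vertices : ∀ {x y} → Walk x y → List V
  vertices (stop x)     = x ∷ []
  vertices (x ∷⟨ _ ⟩ w) = x ∷ vertices w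

  edgesOf : ∀ {x y} → Walk x y → List (V × V)
  edgesOf (stop _) = []
  edgesOf (_∷⟨_⟩_ x {y} _ w) = (x , y) ∷ edgesOf w

  ranks : ∀ {x y} → Walk x y → List ℕ
  ranks (stop _) = []
  ranks (_∷⟨_⟩_ x {y} _ w) = rank x y ∷ ranks w

  EdgeOn : ∀ {x y} → V → V → Walk x y → Set
  EdgeOn u v w = (u , v) ∈ edgesOf w ⊎ (v , u) ∈ edgesOf w

  IsPath : ∀ {x y} → Walk x y → Set
  IsPath w = Unique (vertices w)

  -- shortest-path distance: d(x,y) ≤ k
  DistLe : V → V → ℕ → Set
  DistLe x y k = Σ (Walk x y) λ w → len w ≤ k

  DistLeℤ : V → V → ℤ → Set
  DistLeℤ x y k = Σ (Walk x y) λ w → (+ len w) ℤ.≤ k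

  PathLe : ∀ {x y x' y'} → Walk x y → Walk x' y' → Set
  PathLe p q = LexLe (reverse (ranks p)) (reverse (ranks q))

  IsP : (a b : V) → Walk a b → Set
  IsP a b p = IsPath p
            × (∀ (q : Walk a b) → IsPath q → len p ≤ len q)
            × (∀ (q : Walk a b) → IsPath q → len q ≡ len p → PathLe p q)

  OnP : V → V → V → Set
  OnP a b u = Σ (Walk a b) λ p → IsP a b p × u ∈ vertices p

  module _ (d : ℤ) (ℓ : ℕ) (A B : V → Set) where

    IsCab : V → V → V → Set
    IsCab a b c = Σ (Walk a b) λ p → IsP a b p × nth (vertices p) (ℓ ∸ 3) ≡ just c

    IsCba : V → V → V → Set
    IsCba a b c = Σ (Walk a b) λ p → IsP a b p × nth (vertices p) (len p ∸ (ℓ ∸ 3)) ≡ just c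

    InAB : V → Set
    InAB v = A v ⊎ B v

    record Localized : Set where
      field
        disjoint : ∀ v → A v → B v → ⊥
        far      : ∀ x y → InAB x → InAB y → x ≢ y → ¬ DistLe x y ℓ
        near     : ∀ a b → A a → B b →
                   DistLeℤ a b (+ (2 * ℓ) - + pow2ceil (d ℤ.+ + 2) - + 3)

    BallMeets : V → V → V → Set
    BallMeets c a b = ∀ v → InAB v → (DistLe c v ℓ → (v ≡ a ⊎ v ≡ b))
                                   × ((v ≡ a ⊎ v ≡ b) → DistLe c v ℓ)

    record Independent : Set where
      field
        localized : Localized
        ball-ab   : ∀ a b → A a → B b → ∀ c → IsCab a b c → BallMeets c a b
        ball-ba   : ∀ a b → A a → B b → ∀ c → IsCba a b c → BallMeets c a b

    RS : V → V → Set
    RS a u = Σ V λ b → B b × (Σ (Walk a b) λ p → IsP a b p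
                                × u ∈ take (suc (ℓ ∸ 3)) (vertices p))

    Escape : V → V → V → Set
    Escape a u v = A a × Adj u v × RS a u × ¬ RS a v
                 × (∀ b' → B b' → ∀ (p : Walk a b') → IsP a b' p → ¬ EdgeOn u v p)

    EscapeTo : V → V → V → V → V → Set
    EscapeTo a a' b u v = Escape a u v × A a' × a' ≢ a × B b × OnP a b u × OnP a' b v

    EscArc : V → V → V → Set
    EscArc b a a' = Σ V λ u → Σ V λ v → EscapeTo a a' b u v

    Covered : Set
    Covered = ∀ v → Σ V λ a → Σ V λ b → A a × B b × OnP a b v

  DirCycle : (V → V → Set) → Set
  DirCycle R = Σ V λ x → Σ (List V) λ xs →
               Unique (x ∷ xs) × Linked R (x ∷ xs ++ [ x ])

-- The potential is the length of the canonical paths: an arc a → a' in the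
-- escape graph of b forces |P_ab| < |P_a'b|.  Indeed, let uv be the escape,
-- u at position i ≤ ℓ-3 on some P_ab'' (u lies in the root section of a) and
-- v at position j on P_a'b.  The vertex c'' at position ℓ-3 of P_ab'' is
-- c_ab'', whose ℓ-ball meets A only in a, so
--     ℓ < d(c'', a') ≤ (ℓ-3 - i) + 1 + j,
-- and since ℓ ≥ 2 this gives i + 1 < j.  Going from a to u along P_ab'',
-- across uv and along P_a'b from v to b is a walk of length
-- i + 1 + (|P_a'b| - j) < |P_a'b|, and P_ab is no longer than it.
-- A strictly increasing potential admits no closed directed walk.
module Submission where

open import Defs
open import Data.Nat using (ℕ; zero; suc; _+_; _≤_; _<_; _∸_; z≤n; s≤s; s≤s⁻¹; _*_)
open import Data.Nat.Properties
open import Data.Integer using (ℤ)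
import Data.Integer as ℤ
import Data.Integer.Properties as ℤP
import Data.Fin.Properties as FinP
open import Data.List using ([]; _∷_; _++_; [_]; take)
open import Data.List.Membership.Propositional using (_∈_)
open import Data.List.Relation.Unary.Any using (here; there)
open import Data.List.Relation.Unary.All using ([])
open import Data.List.Relation.Unary.All.Properties using (¬Any⇒All¬)
open import Data.List.Relation.Unary.AllPairs using ([]; _∷_)
open import Data.List.Relation.Unary.Linked using (Linked; [-]; _∷_)
open import Data.Maybe using (just)
open import Data.Product using (Σ; _×_; _,_; proj₁; proj₂)
open import Data.Sum using (inj₁; inj₂)
open import Relation.Nullary using (¬_; yes; no)
open import Relation.Binary.PropositionalEquality
  using (_≡_; _≢_; refl; sym; cong; subst; module ≡-Reasoning)

∈⇒position : ∀ {X : Set} {x : X} xs → x ∈ xs → Σ ℕ λ k → nth xs k ≡ just x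
∈⇒position (y ∷ xs) (here refl) = 0 , refl
∈⇒position (y ∷ xs) (there x∈xs) =
  let (k , at) = ∈⇒position xs x∈xs in suc k , at

∈take⇒position : ∀ {X : Set} {x : X} m xs → x ∈ take m xs →
                 Σ ℕ λ k → k < m × nth xs k ≡ just x
∈take⇒position (suc m) (y ∷ xs) (here refl) = 0 , s≤s z≤n , refl
∈take⇒position (suc m) (y ∷ xs) (there x∈) =
  let (k , k<m , at) = ∈take⇒position m xs x∈ in suc k , s≤s k<m , at

pow2ceil-positive : ∀ z → 1 ≤ pow2ceil z
pow2ceil-positive (ℤ.+ k)    = m^n>0 2 k
pow2ceil-positive ℤ.-[1+ _ ] = ≤-refl

budget-mono : ∀ t {p} → 1 ≤ p → t ℤ.- ℤ.+ p ℤ.- ℤ.+ 3 ℤ.≤ t ℤ.- ℤ.+ 1 ℤ.- ℤ.+ 3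
budget-mono t 1≤p = ℤP.+-monoˡ-≤ (ℤ.- ℤ.+ 3) (ℤP.+-monoʳ-≤ t (ℤP.neg-mono-≤ (ℤ.+≤+ 1≤p)))

-- The distance bound 2ℓ - ⌈2^(d+2)⌉ - 3 of a localized pair is negative
-- unless ℓ ≥ 2, so a localized pair forces ℓ ≥ 2.
budget-nonneg⇒2≤ℓ : ∀ m ℓ p → 1 ≤ p →
                    ℤ.+ m ℤ.≤ ℤ.+ (2 * ℓ) ℤ.- ℤ.+ p ℤ.- ℤ.+ 3 → 2 ≤ ℓ
budget-nonneg⇒2≤ℓ m (suc (suc ℓ)) p _ _ = s≤s (s≤s z≤n)
budget-nonneg⇒2≤ℓ m 0 p 1≤p h with ℤP.≤-trans h (budget-mono (ℤ.+ 0) 1≤p)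
... | ()
budget-nonneg⇒2≤ℓ m 1 p 1≤p h with ℤP.≤-trans h (budget-mono (ℤ.+ 2) 1≤p)
... | ()

2≤ℓ⇒ℓ∸3+2≤ℓ : ∀ ℓ → 2 ≤ ℓ → (ℓ ∸ 3) + 2 ≤ ℓ
2≤ℓ⇒ℓ∸3+2≤ℓ 1 (s≤s ())
2≤ℓ⇒ℓ∸3+2≤ℓ 2 _ = ≤-refl
2≤ℓ⇒ℓ∸3+2≤ℓ (suc (suc (suc m))) _ = subst (_≤ 3 + m) (+-comm 2 m) (n≤1+n _)

gap-bound : ∀ {i j L ℓ} → i ≤ L → L + 2 ≤ ℓ → ℓ < (L ∸ i) + suc j → suc i < j
gap-bound {i} {j} {L} {ℓ} i≤L L+2≤ℓ ℓ< =
  s≤s⁻¹ (+-cancelˡ-< L (suc (suc i)) (suc j) (begin-strict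
    L + suc (suc i)        ≡⟨ sym (+-assoc L 2 i) ⟩
    (L + 2) + i            ≤⟨ +-monoˡ-≤ i L+2≤ℓ ⟩
    ℓ + i                  <⟨ +-monoˡ-< i ℓ< ⟩
    (L ∸ i + suc j) + i    ≡⟨ +-assoc (L ∸ i) (suc j) i ⟩
    L ∸ i + (suc j + i)    ≡⟨ cong (L ∸ i +_) (+-comm (suc j) i) ⟩
    L ∸ i + (i + suc j)    ≡⟨ sym (+-assoc (L ∸ i) i (suc j)) ⟩
    (L ∸ i + i) + suc j    ≡⟨ cong (_+ suc j) (m∸n+n≡m i≤L) ⟩
    L + suc j              ∎))
  where open ≤-Reasoning

module Descent {X : Set} (R : X → X → Set) (H : X → ℕ → Set)
  (H-functional : ∀ {x k k'} → H x k → H x k' → k ≡ k')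
  (H-source     : ∀ {x y} → R x y → Σ ℕ (H x))
  (H-increases  : ∀ {x y} → R x y → ∀ {k} → H x k → Σ ℕ λ k' → H y k' × k < k')
  where

  increases-along : ∀ x ys z → Linked R (x ∷ ys ++ [ z ]) →
                    ∀ {k} → H x k → Σ ℕ λ k' → H z k' × k < k'
  increases-along x []       z (r ∷ [-])  hx = H-increases r hx
  increases-along x (y ∷ ys) z (r ∷ rest) hx =
    let (k₁ , hy , k<k₁) = H-increases r hx
        (k₂ , hz , k₁<k₂) = increases-along y ys z rest hy
    in k₂ , hz , <-trans k<k₁ k₁<k₂

  first-step : ∀ x ys z → Linked R (x ∷ ys ++ [ z ]) → Σ X (R x)
  first-step x []       z (r ∷ _) = z , r
  first-step x (y ∷ ys) z (r ∷ _) = y , r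

  no-closed-walk : ∀ x ys → ¬ Linked R (x ∷ ys ++ [ x ])
  no-closed-walk x ys walk =
    let (k , hx) = H-source (proj₂ (first-step x ys x walk))
        (k' , hx' , k<k') = increases-along x ys x walk hx
    in <-irrefl (H-functional hx hx') k<k'

module Walks (G : Graph) where
  open Graph G
  open import Data.List.Membership.DecPropositional (FinP._≟_ {n}) using (_∈?_)

  _++w_ : ∀ {x y z} → Walk G x y → Walk G y z → Walk G x z
  stop _       ++w q = q
  (x ∷⟨ e ⟩ p) ++w q = x ∷⟨ e ⟩ (p ++w q)

  len-++ : ∀ {x y z} (p : Walk G x y) (q : Walk G y z) →
           len G (p ++w q) ≡ len G p + len G q
  len-++ (stop _)     q = refl
  len-++ (x ∷⟨ e ⟩ p) q = cong suc (len-++ p q)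

  reverse : ∀ {x y} → Walk G x y → Walk G y x
  reverse (stop x)     = stop x
  reverse (x ∷⟨ e ⟩ p) = reverse p ++w (_ ∷⟨ Adj-sym e ⟩ stop x)

  len-reverse : ∀ {x y} (p : Walk G x y) → len G (reverse p) ≡ len G p
  len-reverse (stop x)     = refl
  len-reverse (x ∷⟨ e ⟩ p) = begin
    len G (reverse p ++w (_ ∷⟨ Adj-sym e ⟩ stop x)) ≡⟨ len-++ (reverse p) _ ⟩
    len G (reverse p) + 1                            ≡⟨ +-comm _ 1 ⟩
    suc (len G (reverse p))                          ≡⟨ cong suc (len-reverse p) ⟩
    suc (len G p)                                    ∎
    where open ≡-Reasoning

  dist-refl : ∀ x → DistLe G x x 0
  dist-refl x = stop x , z≤n

  dist-sym : ∀ {x y k} → DistLe G x y k → DistLe G y x k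
  dist-sym (p , le) = reverse p , subst (_≤ _) (sym (len-reverse p)) le

  dist-trans : ∀ {x y z k m} → DistLe G x y k → DistLe G y z m → DistLe G x z (k + m)
  dist-trans (p , le) (q , le') = p ++w q , subst (_≤ _) (sym (len-++ p q)) (+-mono-≤ le le')

  dist-edge : ∀ {x y} → Adj x y → DistLe G x y 1
  dist-edge {x} {y} e = x ∷⟨ e ⟩ stop y , ≤-refl

  beyond : ∀ {x y ℓ k} → ¬ DistLe G x y ℓ → DistLe G x y k → ℓ < k
  beyond far (p , le) = ≰⇒> λ k≤ℓ → far (p , ≤-trans le k≤ℓ)

  position≤len : ∀ {s t x} (w : Walk G s t) k → nth (vertices G w) k ≡ just x → k ≤ len G w
  position≤len (stop s)     zero    _  = z≤n
  position≤len (s ∷⟨ e ⟩ w) zero    _  = z≤n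
  position≤len (s ∷⟨ e ⟩ w) (suc k) at = s≤s (position≤len w k at)

  vertex-at : ∀ {s t} (w : Walk G s t) k → k ≤ len G w →
              Σ (V G) λ x → nth (vertices G w) k ≡ just x
  vertex-at (stop s)     zero    _         = s , refl
  vertex-at (s ∷⟨ e ⟩ w) zero    _         = s , refl
  vertex-at (s ∷⟨ e ⟩ w) (suc k) (s≤s k≤) = vertex-at w k k≤

  start-at-0 : ∀ {s t} (w : Walk G s t) → nth (vertices G w) 0 ≡ just s
  start-at-0 (stop s)     = refl
  start-at-0 (s ∷⟨ e ⟩ w) = refl

  between : ∀ {s t x y} (w : Walk G s t) {k m} → k ≤ m →
            nth (vertices G w) k ≡ just x → nth (vertices G w) m ≡ just y →
            DistLe G x y (m ∸ k)
  between (stop s)     {zero}  {zero}  _         refl refl = dist-refl s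
  between (s ∷⟨ e ⟩ w) {zero}  {zero}  _         refl refl = dist-refl s
  between (s ∷⟨ e ⟩ w) {zero}  {suc m} _         refl ey   =
    dist-trans (dist-edge e) (between w z≤n (start-at-0 w) ey)
  between (s ∷⟨ e ⟩ w) {suc k} {suc m} (s≤s k≤m) ex   ey   = between w k≤m ex ey

  to-end : ∀ {s t x} (w : Walk G s t) k → nth (vertices G w) k ≡ just x →
           DistLe G x t (len G w ∸ k)
  to-end (stop s)     zero    refl = dist-refl s
  to-end (s ∷⟨ e ⟩ w) zero    refl = s ∷⟨ e ⟩ w , ≤-refl
  to-end (s ∷⟨ e ⟩ w) (suc k) at   = to-end w k at

  drop-to : ∀ {x y z} (w : Walk G y z) → x ∈ vertices G w →
            Σ (Walk G x z) λ q → len G q ≤ len G w × (IsPath G w → IsPath G q)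
  drop-to (stop y)     (here refl) = stop y , z≤n , λ u → u
  drop-to (y ∷⟨ e ⟩ w) (here refl) = y ∷⟨ e ⟩ w , ≤-refl , λ u → u
  drop-to (y ∷⟨ e ⟩ w) (there x∈) =
    let (q , le , keep) = drop-to w x∈ in q , m≤n⇒m≤1+n le , λ { (_ ∷ u) → keep u }

  to-path : ∀ {y z} (w : Walk G y z) → Σ (Walk G y z) λ q → len G q ≤ len G w × IsPath G q
  to-path (stop y) = stop y , z≤n , ([] ∷ [])
  to-path (x ∷⟨ e ⟩ w) with to-path w
  ... | p , le , path with x ∈? vertices G p
  ...   | yes x∈ = let (q , le' , keep) = drop-to p x∈ in q , ≤-trans le' (m≤n⇒m≤1+n le) , keep path
  ...   | no  x∉ = x ∷⟨ e ⟩ p , s≤s le , (¬Any⇒All¬ _ x∉ ∷ path)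

  P-shortest : ∀ {a b k} {p : Walk G a b} → IsP G a b p → DistLe G a b k → len G p ≤ k
  P-shortest (_ , minimal , _) (w , le) =
    let (q , q≤w , path) = to-path w in ≤-trans (minimal q path) (≤-trans q≤w le)

  P-len-unique : ∀ {a b} {p q : Walk G a b} → IsP G a b p → IsP G a b q → len G p ≡ len G q
  P-len-unique {q = q} ip iq = ≤-antisym (P-shortest ip (q , ≤-refl)) (P-shortest iq (_ , ≤-refl))

module EscapeArcs (G : Graph) (d : ℤ) (ℓ : ℕ) (A B : V G → Set)
                  (I : Independent G d ℓ A B) where
  open Graph G
  open Walks G
  open Independent I
  open Localized localized

  -- L is the position of c_ab on P_ab.
  L : ℕ
  L = ℓ ∸ 3

  A≢B : ∀ {x y} → A x → B y → x ≢ y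
  A≢B {x} ax by refl = disjoint x ax by

  L+2≤ℓ : ∀ {a b} → A a → B b → L + 2 ≤ ℓ
  L+2≤ℓ {a} {b} Aa Bb =
    2≤ℓ⇒ℓ∸3+2≤ℓ ℓ (budget-nonneg⇒2≤ℓ (len G w) ℓ _ (pow2ceil-positive (d ℤ.+ ℤ.+ 2)) bound)
    where
      w = proj₁ (near a b Aa Bb)
      bound = proj₂ (near a b Aa Bb)

  L≤len : ∀ {a b} → A a → B b → (w : Walk G a b) → L ≤ len G w
  L≤len {a} {b} Aa Bb w =
    ≤-trans (m∸n≤m ℓ 3) (<⇒≤ (beyond (far a b (inj₁ Aa) (inj₂ Bb) (A≢B Aa Bb)) (w , ≤-refl)))

  c-far-from-A : ∀ {a b c a'} {p : Walk G a b} → A a → B b → IsP G a b p →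
                 nth (vertices G p) L ≡ just c → A a' → a' ≢ a → ¬ DistLe G c a' ℓ
  c-far-from-A {a} {b} {c} {a'} {p} Aa Bb ip ec Aa' a'≢a near-c
    with proj₁ (ball-ab a b Aa Bb c (p , ip , ec) a' (inj₁ Aa')) near-c
  ... | inj₁ a'≡a = a'≢a a'≡a
  ... | inj₂ a'≡b = A≢B Aa' Bb a'≡b

  -- If u is in the root part (position i ≤ L) of some P_ab'' and its
  -- neighbour v lies at position j of a walk starting at another a' ∈ A,
  -- then j > i + 1: otherwise c_ab'' would be within ℓ of a'.
  root-neighbour-gap : ∀ {a b'' a' t u v i j} {p'' : Walk G a b''} →
                       A a → B b'' → IsP G a b'' p'' → i ≤ L →
                       nth (vertices G p'') i ≡ just u → Adj u v →
                       A a' → a' ≢ a → (w : Walk G a' t) →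
                       nth (vertices G w) j ≡ just v → suc i < j
  root-neighbour-gap {p'' = p''} Aa Bb'' ip'' i≤L eu uv Aa' a'≢a w ev =
    gap-bound i≤L (L+2≤ℓ Aa Bb'') (beyond (c-far-from-A Aa Bb'' ip'' ec Aa' a'≢a) c→a')
    where
      ec = proj₂ (vertex-at p'' L (L≤len Aa Bb'' p''))
      c→a' = dist-trans (dist-sym (between p'' i≤L eu ec))
               (dist-trans (dist-edge uv) (dist-sym (between w z≤n (start-at-0 w) ev)))

  -- An escape from a to a' for b makes P_ab strictly shorter than P_a'b:
  -- a → u (root part) → v → b (along P_a'b) undercuts P_a'b.
  escape-lengthens : ∀ {a a' b u v} → EscapeTo G d ℓ A B a a' b u v →
                     ∀ {q : Walk G a b} {p' : Walk G a' b} →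
                     IsP G a b q → IsP G a' b p' → len G q < len G p'
  escape-lengthens
    ((Aa , uv , (b'' , Bb'' , p'' , ip'' , u∈root) , _ , _) , Aa' , a'≢a , _ , _ , (p , ip , v∈p))
    {q} {p'} iq ip' = begin-strict
      len G q                 ≤⟨ P-shortest iq a→u→v→b ⟩
      i + (1 + (len G p ∸ j)) ≡⟨ +-suc i _ ⟩
      suc i + (len G p ∸ j)   <⟨ +-monoˡ-< _ gap ⟩
      j + (len G p ∸ j)       ≡⟨ m+[n∸m]≡n (position≤len p j ej) ⟩
      len G p                 ≡⟨ P-len-unique ip ip' ⟩
      len G p'                ∎
    where
      open ≤-Reasoning
      u-position = ∈take⇒position (suc L) (vertices G p'') u∈root
      i = proj₁ u-position
      i≤L = s≤s⁻¹ (proj₁ (proj₂ u-position))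
      eu = proj₂ (proj₂ u-position)
      v-position = ∈⇒position (vertices G p) v∈p
      j = proj₁ v-position
      ej = proj₂ v-position
      gap = root-neighbour-gap Aa Bb'' ip'' i≤L eu uv Aa' a'≢a p ej
      a→u→v→b = dist-trans (between p'' z≤n (start-at-0 p'') eu)
                  (dist-trans (dist-edge uv) (to-end p j ej))

-- The escape graph of b is acyclic: the length of P_ab is a potential
-- that every arc raises.
lemma23 : (G : Graph) (d : ℤ) (ℓ : ℕ) (A B : V G → Set) →
          Independent G d ℓ A B → Covered G d ℓ A B →
          ∀ b → B b → ¬ DirCycle G (EscArc G d ℓ A B b)
lemma23 G d ℓ A B I _ b _ (x , xs , _ , closed) =
  Descent.no-closed-walk (EscArc G d ℓ A B b) P-length
    P-length-functional source increases x xs closed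
  where
    open Walks G
    open EscapeArcs G d ℓ A B I

    P-length : V G → ℕ → Set
    P-length a k = Σ (Walk G a b) λ p → IsP G a b p × len G p ≡ k

    P-length-functional : ∀ {a k k'} → P-length a k → P-length a k' → k ≡ k'
    P-length-functional (_ , ip , refl) (_ , ip' , refl) = P-len-unique ip ip'

    source : ∀ {a a'} → EscArc G d ℓ A B b a a' → Σ ℕ (P-length a)
    source (_ , _ , (_ , _ , _ , _ , (p , ip , _) , _)) = len G p , p , ip , refl

    increases : ∀ {a a'} → EscArc G d ℓ A B b a a' →
                ∀ {k} → P-length a k → Σ ℕ λ k' → P-length a' k' × k < k'
    increases (_ , _ , esc@(_ , _ , _ , _ , _ , (p' , ip' , _))) (_ , ip , refl) =
      len G p' , (p' , ip' , refl) , escape-lengthens esc ip ip'
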